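{- Let $N$ be a project, $k\ge 1$ an integer, and $X$ a $k$-crashing plan of $N$. Then $X$ contains a cut of the critical graph $N^*$; that is, there is a partition of the vertex set into $S\ni s$ and $T\ni t$ such that every edge of $N^*$ going from $S$ to $T$ has positive multiplicity in $X$.
   Context: A project is a finite directed acyclic graph $N=(V,E)$ with a unique source $s$ and a unique sink $t$. Each edge $e_i$ has attributes $(a_i,b_i,c_i)$: integers $0\le a_i\le b_i$ and a cost rate $c_i\ge0$; the length of $e_i$ is $b_i$. A path means a directed $s$–$t$ path; its length is the sum of its edge lengths; the duration $d(N)$ is the maximum path length. A critical path is a path of maximum length; a critical edge is an edge lying on some critical path. The critical graph $N^*$ is the graph on $V$ whose edges are exactly the critical edges of $N$ (with the same attributes). A cut of a graph with source $s$ and sink $t$ is the set of edges going from $S$ to $T$ for some partition $(S,T)$ of its vertices with $s\in S$, $t\in T$. A plan $X$ is a multiset of edges of $N$ with $e_i$ of multiplicity $x_i$, $0\le x_i\le b_i-a_i$. $N(X)$ is obtained from $N$ by replacing each $b_i$ by $b_i-x_i$. $X$ is $k$-crashing for $N$ if $d(N(X))=d(N)-k$. -}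

module Defs where

open import Data.Nat using (ℕ; zero; suc; _+_; _∸_; _≤_; _≥_)
open import Data.Fin using (Fin)
open import Data.Bool using (Bool; true; false)
open import Data.Product using (Σ; ∃; _×_; _,_)
open import Relation.Binary.PropositionalEquality using (_≡_; _≢_)
open import Relation.Nullary using (¬_)
open import Data.Empty using (⊥)

record Edge (n : ℕ) : Set where
  field
    tail : Fin n
    head : Fin n
    a    : ℕ
    b    : ℕ
    c    : ℕ
    a≤b  : a ≤ b

open Edge public

record Network : Set where
  field
    n     : ℕ
    m     : ℕ
    edge  : Fin m → Edge n
    s     : Fin n
    t     : Fin n

open Network public

module _ (N : Network) where

  data Walk : Fin (n N) → Fin (n N) → Set where
    []  : ∀ {u} → Walk u u
    _∷⟨_⟩_ : ∀ {v} (i : Fin (m N)) {u} → tail (edge N i) ≡ u →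
             Walk (head (edge N i)) v → Walk u v

  data _∈W_ (i : Fin (m N)) : ∀ {u v} → Walk u v → Set where
    here  : ∀ {u v} {p : tail (edge N i) ≡ u} {w : Walk (head (edge N i)) v} →
            i ∈W (i ∷⟨ p ⟩ w)
    there : ∀ {j u v} {p : tail (edge N j) ≡ u} {w : Walk (head (edge N j)) v} →
            i ∈W w → i ∈W (j ∷⟨ p ⟩ w)

  walkLen : (Fin (m N) → ℕ) → ∀ {u v} → Walk u v → ℕ
  walkLen ℓ []            = 0
  walkLen ℓ (i ∷⟨ _ ⟩ w) = ℓ i + walkLen ℓ w

  Acyclic : Set
  Acyclic = ∀ {u} (i : Fin (m N)) (p : tail (edge N i) ≡ u)
              (w : Walk (head (edge N i)) u) → ⊥

  UniqueSource : Set
  UniqueSource = (∀ i → head (edge N i) ≢ s N)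
               × (∀ v → v ≢ s N → ∃ λ i → head (edge N i) ≡ v)

  UniqueSink : Set
  UniqueSink = (∀ i → tail (edge N i) ≢ t N)
             × (∀ v → v ≢ t N → ∃ λ i → tail (edge N i) ≡ v)

  IsProject : Set
  IsProject = Acyclic × UniqueSource × UniqueSink

  -- A path is a directed s–t path (in a DAG every walk is a path).
  Path : Set
  Path = Walk (s N) (t N)

  len : Fin (m N) → ℕ
  len i = b (edge N i)

  IsDuration : (Fin (m N) → ℕ) → ℕ → Set
  IsDuration ℓ D = (∃ λ (p : Path) → walkLen ℓ p ≡ D)
                 × (∀ (p : Path) → walkLen ℓ p ≤ D)

  IsCriticalPath : Path → Set
  IsCriticalPath p = ∀ (q : Path) → walkLen len q ≤ walkLen len p

  IsCriticalEdge : Fin (m N) → Set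
  IsCriticalEdge i = ∃ λ (p : Path) → IsCriticalPath p × i ∈W p

  IsPlan : (Fin (m N) → ℕ) → Set
  IsPlan x = ∀ i → x i ≤ b (edge N i) ∸ a (edge N i)

  crashedLen : (Fin (m N) → ℕ) → Fin (m N) → ℕ
  crashedLen x i = b (edge N i) ∸ x i

  -- X is k-crashing: d(N(X)) = d(N) - k  (as integers, i.e. d(N(X)) + k = d(N)).
  IsKCrashing : ℕ → (Fin (m N) → ℕ) → Set
  IsKCrashing k x = Σ ℕ λ D → Σ ℕ λ D' →
    IsDuration len D × IsDuration (crashedLen x) D' × D' + k ≡ D

  -- X contains a cut of N*: a partition (S,T) of the vertices, given by the
  -- indicator S : vertices → Bool (true = in S), with s ∈ S, t ∈ T, such that
  -- every critical edge from S to T has positive multiplicity in X.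
  ContainsCutOfCritical : (Fin (m N) → ℕ) → Set
  ContainsCutOfCritical x = Σ (Fin (n N) → Bool) λ S →
      S (s N) ≡ true × S (t N) ≡ false
    × (∀ i → IsCriticalEdge i → S (tail (edge N i)) ≡ true →
             S (head (edge N i)) ≡ false → x i ≥ 1)

{-# OPTIONS --safe #-}
-- Let S be the set of vertices u through which some s–t path still has
-- length at least d(N) when only its part before u is crashed by X.  A
-- critical path puts s in S, and t ∉ S because a fully crashed path has
-- length at most d(N) − k < d(N).  If a critical edge u → v with u ∈ S were
-- not crashed, follow the crashed prefix into u by that edge and then the rest
-- of a critical path through it; since that rest is a longest u–t walk, v ∈ S.
-- Hence every critical edge leaving S is crashed.  Membership in S is
-- decidable because in an acyclic graph every walk has fewer than |V| edges.
module Submission where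

open import Defs
open import Data.Nat using (ℕ; zero; suc; _+_; _∸_; _≤_; _<_; _≥_; z≤n; s≤s; _≤?_)
open import Data.Nat.Properties
  using (≤-reflexive; ≤-trans; ≤-<-trans; <⇒≤; ≰⇒>; <⇒≱; +-assoc; +-identityʳ;
         +-monoʳ-≤; +-cancelˡ-≤; m<m+n; n≢0⇒n>0; module ≤-Reasoning)
import Data.Fin as Fin
open import Data.Fin using (Fin; _≟_)
open import Data.Fin.Properties using (pigeonhole; any?)
open import Data.Bool using (true; false)
open import Data.Product using (Σ; ∃; ∃₂; _×_; _,_; proj₁)
open import Data.Sum using (inj₁; inj₂)
open import Data.Empty using (⊥-elim)
open import Function using (_∘_)
open import Relation.Nullary using (¬_; Dec; yes; no; does)
open import Relation.Nullary.Decidable using (map′; _⊎-dec_; dec-true; dec-false)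
open import Level using (0ℓ)
open import Relation.Unary using (Pred; Decidable)
open import Relation.Binary.PropositionalEquality
  using (_≡_; _≢_; refl; sym; trans; cong; subst; subst₂)
open import Axiom.UniquenessOfIdentityProofs using (module Decidable⇒UIP)

module _ {N : Network} where

  _++_ : ∀ {u v w} → Walk N u v → Walk N v w → Walk N u w
  []           ++ q = q
  (i ∷⟨ e ⟩ p) ++ q = i ∷⟨ e ⟩ (p ++ q)

  walkLen-++ : ∀ ℓ {u v w} (p : Walk N u v) (q : Walk N v w) →
               walkLen N ℓ (p ++ q) ≡ walkLen N ℓ p + walkLen N ℓ q
  walkLen-++ ℓ []           q = refl
  walkLen-++ ℓ (i ∷⟨ _ ⟩ p) q =
    trans (cong (ℓ i +_) (walkLen-++ ℓ p q)) (sym (+-assoc (ℓ i) _ _))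

  ∈W-split : ∀ {i u v} {p : Walk N u v} → _∈W_ N i p →
             ∃₂ λ (p₁ : Walk N u (tail (edge N i))) (p₂ : Walk N (head (edge N i)) v) →
               p ≡ p₁ ++ (i ∷⟨ refl ⟩ p₂)
  ∈W-split (here {p = refl} {w = p₂}) = [] , p₂ , refl
  ∈W-split (there {j} {p = e} i∈p) with ∈W-split i∈p
  ... | p₁ , p₂ , refl = j ∷⟨ e ⟩ p₁ , p₂ , refl

  size : ∀ {u v} → Walk N u v → ℕ
  size []           = 0
  size (_ ∷⟨ _ ⟩ p) = suc (size p)

  vertex : ∀ {u v} (p : Walk N u v) → Fin (suc (size p)) → Fin (n N)
  vertex {u} _        Fin.zero    = u
  vertex (_ ∷⟨ _ ⟩ p) (Fin.suc j) = vertex p j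

  prefix : ∀ {u v} (p : Walk N u v) (j : Fin (suc (size p))) → Walk N u (vertex p j)
  prefix _            Fin.zero    = []
  prefix (i ∷⟨ e ⟩ p) (Fin.suc j) = i ∷⟨ e ⟩ prefix p j

  open Decidable⇒UIP (_≟_ {n N}) using (≡-irrelevant)

  any-walk≤? : ∀ L {u v} (P : Pred (Walk N u v) 0ℓ) → Decidable P →
               Dec (∃ λ p → size p ≤ L × P p)
  any-step? : ∀ L {u v} (P : Pred (Walk N u v) 0ℓ) → Decidable P → ∀ i →
              Dec (Σ (tail (edge N i) ≡ u) λ e → ∃ λ p → size p ≤ L × P (i ∷⟨ e ⟩ p))

  any-walk≤? zero {u} {v} P P? with u ≟ v
  ... | no u≢v   = no λ { ([] , _) → u≢v refl ; (_ ∷⟨ _ ⟩ _ , () , _) }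
  ... | yes refl = map′ (λ P[] → [] , z≤n , P[])
                        (λ { ([] , _ , P[]) → P[] ; (_ ∷⟨ _ ⟩ _ , () , _) })
                        (P? [])
  any-walk≤? (suc L) P P? =
    map′ (λ { (inj₁ (p , p≤0 , Pp)) → p , ≤-trans p≤0 z≤n , Pp
            ; (inj₂ (i , e , p , p≤L , Pp)) → i ∷⟨ e ⟩ p , s≤s p≤L , Pp })
         (λ { ([] , _ , P[]) → inj₁ ([] , z≤n , P[])
            ; (i ∷⟨ e ⟩ p , s≤s p≤L , Pp) → inj₂ (i , e , p , p≤L , Pp) })
         (any-walk≤? zero P P? ⊎-dec any? (any-step? L P P?))

  any-step? L {u} P P? i with tail (edge N i) ≟ u
  ... | no  tail≢u = no (tail≢u ∘ proj₁)
  ... | yes e      =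
    map′ (e ,_)
         (λ (e′ , p , p≤L , Pp) → p , p≤L , subst (λ e → P (i ∷⟨ e ⟩ p)) (≡-irrelevant e′ e) Pp)
         (any-walk≤? L (P ∘ (i ∷⟨ e ⟩_)) (P? ∘ (i ∷⟨ e ⟩_)))

  module _ (acyclic : Acyclic N) where

    closed-walkLen≡0 : ∀ ℓ {u} (p : Walk N u u) → walkLen N ℓ p ≡ 0
    closed-walkLen≡0 ℓ []           = refl
    closed-walkLen≡0 ℓ (i ∷⟨ e ⟩ p) = ⊥-elim (acyclic i e p)

    vertices-distinct : ∀ {u v} (p : Walk N u v) {j k} → j Fin.< k → vertex p j ≢ vertex p k
    vertices-distinct (i ∷⟨ e ⟩ p) {Fin.zero}  {Fin.suc k} _         same =
      acyclic i e (subst (Walk N _) (sym same) (prefix p k))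
    vertices-distinct (_ ∷⟨ _ ⟩ p) {Fin.suc j} {Fin.suc k} (s≤s j<k) =
      vertices-distinct p j<k

    size<n : ∀ {u v} (p : Walk N u v) → size p < n N
    size<n p = ≰⇒> λ n≤size →
      let j , k , j<k , same = pigeonhole (s≤s n≤size) (vertex p)
      in vertices-distinct p j<k same

    any-walk? : ∀ {u v} (P : Pred (Walk N u v) 0ℓ) → Decidable P → Dec (∃ P)
    any-walk? P P? = map′ (λ (p , _ , Pp) → p , Pp)
                          (λ (p , Pp) → p , <⇒≤ (size<n p) , Pp)
                          (any-walk≤? (n N) P P?)

module _ (N : Network) where

  suffix-maximal : ∀ {u} (p : Walk N (s N) u) (q : Walk N u (t N)) →
                   IsCriticalPath N (p ++ q) →
                   (q′ : Walk N u (t N)) → walkLen N (len N) q′ ≤ walkLen N (len N) q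
  suffix-maximal p q critical q′ =
    +-cancelˡ-≤ (walkLen N (len N) p) _ _
      (subst₂ _≤_ (walkLen-++ _ p q′) (walkLen-++ _ p q) (critical (p ++ q′)))

  module _ (ℓ : Fin (m N) → ℕ) (D : ℕ) where

    LongThrough : Pred (Fin (n N)) 0ℓ
    LongThrough u = ∃₂ λ (p : Walk N (s N) u) (q : Walk N u (t N)) →
                      D ≤ walkLen N ℓ p + walkLen N (len N) q

    longThrough? : Acyclic N → Decidable LongThrough
    longThrough? acyclic u =
      any-walk? acyclic _ λ p → any-walk? acyclic _ λ q → D ≤? _

    longThrough-source : (p : Path N) → D ≤ walkLen N (len N) p → LongThrough (s N)
    longThrough-source p D≤p = [] , p , D≤p

    ¬longThrough-sink : Acyclic N → (∀ (p : Path N) → walkLen N ℓ p < D) →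
                        ¬ LongThrough (t N)
    ¬longThrough-sink acyclic short (p , q , D≤) = <⇒≱ (short p) (begin
      D                                   ≤⟨ D≤ ⟩
      walkLen N ℓ p + walkLen N (len N) q ≡⟨ cong (walkLen N ℓ p +_) (closed-walkLen≡0 acyclic _ q) ⟩
      walkLen N ℓ p + 0                   ≡⟨ +-identityʳ _ ⟩
      walkLen N ℓ p                       ∎)
      where open ≤-Reasoning

    longThrough-critical : ∀ {i} → IsCriticalEdge N i → ℓ i ≡ len N i →
                           LongThrough (tail (edge N i)) → LongThrough (head (edge N i))
    longThrough-critical {i} (c , c-critical , i∈c) ℓi≡len (p , q , D≤) with ∈W-split i∈c
    ... | c₁ , c₂ , refl = p ++ (i ∷⟨ refl ⟩ []) , c₂ , (begin
      D                                           ≤⟨ D≤ ⟩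
      ℓ⟨ p ⟩ + len⟨ q ⟩                           ≤⟨ +-monoʳ-≤ ℓ⟨ p ⟩ (suffix-maximal c₁ _ c-critical q) ⟩
      ℓ⟨ p ⟩ + (len N i + len⟨ c₂ ⟩)              ≡⟨ cong (λ l → ℓ⟨ p ⟩ + (l + len⟨ c₂ ⟩)) (sym ℓi≡len) ⟩
      ℓ⟨ p ⟩ + (ℓ i + len⟨ c₂ ⟩)                  ≡⟨ sym (+-assoc ℓ⟨ p ⟩ (ℓ i) _) ⟩
      ℓ⟨ p ⟩ + ℓ i + len⟨ c₂ ⟩                    ≡⟨ cong (_+ len⟨ c₂ ⟩) (sym ℓ⟨p∷i⟩) ⟩
      ℓ⟨ p ++ (i ∷⟨ refl ⟩ []) ⟩ + len⟨ c₂ ⟩      ∎)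
      where
      open ≤-Reasoning
      ℓ⟨_⟩ len⟨_⟩ : ∀ {u v} → Walk N u v → ℕ
      ℓ⟨_⟩   = walkLen N ℓ
      len⟨_⟩ = walkLen N (len N)
      ℓ⟨p∷i⟩ : ℓ⟨ p ++ (i ∷⟨ refl ⟩ []) ⟩ ≡ ℓ⟨ p ⟩ + ℓ i
      ℓ⟨p∷i⟩ = trans (walkLen-++ ℓ p _) (cong (ℓ⟨ p ⟩ +_) (+-identityʳ (ℓ i)))

  closed-set⇒cut : (x : Fin (m N) → ℕ) (S : Pred (Fin (n N)) 0ℓ) → Decidable S →
                   S (s N) → ¬ S (t N) →
                   (∀ i → IsCriticalEdge N i → x i ≡ 0 →
                          S (tail (edge N i)) → S (head (edge N i))) →
                   ContainsCutOfCritical N x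
  closed-set⇒cut x S S? s∈S t∉S closed =
    (λ u → does (S? u)) , dec-true (S? (s N)) s∈S , dec-false (S? (t N)) t∉S , crossing
    where
    crossing : ∀ i → IsCriticalEdge N i → does (S? (tail (edge N i))) ≡ true →
               does (S? (head (edge N i))) ≡ false → x i ≥ 1
    crossing i critical _ _ with S? (tail (edge N i)) | S? (head (edge N i))
    crossing i critical _  _  | yes tail∈S | no head∉S =
      n≢0⇒n>0 λ xi≡0 → head∉S (closed i critical xi≡0 tail∈S)
    crossing i critical () _  | no _       | _
    crossing i critical _  () | yes _      | yes _

proposition2p3 : (N : Network) → IsProject N → (k : ℕ) → k ≥ 1 →
    (x : Fin (m N) → ℕ) → IsPlan N x → IsKCrashing N k x →
    ContainsCutOfCritical N x
proposition2p3 N (acyclic , _) k k≥1 x _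
               (D , D′ , ((c , c≡D) , _) , (_ , crashed≤D′) , D′+k≡D) =
  closed-set⇒cut N x (LongThrough N ℓ D) (longThrough? N ℓ D acyclic)
    (longThrough-source N ℓ D c (≤-reflexive (sym c≡D)))
    (¬longThrough-sink N ℓ D acyclic λ p → ≤-<-trans (crashed≤D′ p) D′<D)
    (λ i critical xi≡0 → longThrough-critical N ℓ D critical (cong (b (edge N i) ∸_) xi≡0))
  where
  ℓ : Fin (m N) → ℕ
  ℓ = crashedLen N x
  D′<D : D′ < D
  D′<D = subst (D′ <_) D′+k≡D (m<m+n D′ k≥1)
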